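{- Let $k$ be odd and let $A=[A(i,j)]$ be a Heffter array $H(n;k)$ whose set of non-empty cells is the disjoint union of the diagonals $D_{g(1)},\dots,D_{g(k)}$, where $0\le g(1)<g(2)<\dots<g(k)\le n-1$. Define $s_h=g(h)-g(h-1) \pmod n$ for $h=2,\dots,k$ and $s_1=g(1)-g(k)\pmod n$, and suppose $\gcd(n,s_h)=1$ for all $h=1,\dots,k$. If $A$ is globally simple, then $A$ has an ordering which is both simple and compatible.
   Context: Rows and columns of an $n\times n$ array are indexed by $[n]=\{0,1,\dots,n-1\}$, with indices taken modulo $n$; the diagonal $D_d$ ($d\in[n]$) is the set of cells $\{(i+d,i): i\in[n]\}$. A Heffter array $H(n;k)$ is an $n\times n$ partially filled array of integers such that each row and each column contains exactly $k$ filled cells, the entries of every row and column sum to $0$ modulo $2nk+1$, and for each integer $1\le x\le nk$ either $x$ or $-x$ appears in the array. A cyclic ordering $(a_0,\dots,a_{k-1})$ of the entries of a row or column is simple if the partial sums $\sum_{j=0}^{i}a_j \pmod{2nk+1}$, $i=0,\dots,k-1$, are pairwise distinct. The natural ordering of a row is left to right, of a column top to bottom; the array is globally simple if every natural ordering is simple. An ordering of the array is a choice of a cyclic ordering of the entries of each row and each column; $\omega_r$ (resp. $\omega_c$) is the composition of the row (resp. column) cycles, a permutation of the set of entries; the ordering is simple if all chosen cyclic orderings are simple and compatible if $\omega_r\circ\omega_c$ is a single cycle of length $nk$. -}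

module Defs where

open import Data.Nat as ℕ using (ℕ; zero; suc; _≤ᵇ_; _∸_)
open import Data.Nat.GCD using (gcd)
open import Data.Fin as Fin using (Fin; zero; suc; toℕ; fromℕ; inject₁)
open import Data.Integer as ℤ using (ℤ; +_; -_; _-_)
open import Data.Integer.Divisibility using (_∣_)
open import Data.Maybe using (Maybe; just; nothing; fromMaybe; Is-just)
open import Data.Bool using (Bool; true; false; if_then_else_)
open import Data.Product using (Σ; ∃; _×_; _,_; ∃-syntax)
open import Data.Sum using (_⊎_)
open import Relation.Binary.PropositionalEquality using (_≡_)
open import Relation.Binary.Construct.Closure.ReflexiveTransitive using (Star)

-- A partially filled n×n array of integers: nothing = empty cell.
Array : ℕ → Set
Array n = Fin n → Fin n → Maybe ℤ

Cell : ℕ → Set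
Cell n = Fin n × Fin n

sumℤ : (n : ℕ) → (Fin n → ℤ) → ℤ
sumℤ zero    f = + 0
sumℤ (suc n) f = f zero ℤ.+ sumℤ n (λ i → f (suc i))

sumℕ : (n : ℕ) → (Fin n → ℕ) → ℕ
sumℕ zero    f = 0
sumℕ (suc n) f = f zero ℕ.+ sumℕ n (λ i → f (suc i))

_≡_[mod_] : ℤ → ℤ → ℕ → Set
a ≡ b [mod m ] = + m ∣ (a - b)

filled? : Maybe ℤ → ℕ
filled? (just _) = 1
filled? nothing  = 0

val : Maybe ℤ → ℤ
val = fromMaybe (+ 0)

Filled : ∀ {n} → Array n → Cell n → Set
Filled A (r , c) = Is-just (A r c)

modulus : ℕ → ℕ → ℕ
modulus n k = suc (2 ℕ.* n ℕ.* k)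

record IsHeffter (n k : ℕ) (A : Array n) : Set where
  field
    rowCount : ∀ r → sumℕ n (λ c → filled? (A r c)) ≡ k
    colCount : ∀ c → sumℕ n (λ r → filled? (A r c)) ≡ k
    rowSum   : ∀ r → sumℤ n (λ c → val (A r c)) ≡ + 0 [mod modulus n k ]
    colSum   : ∀ c → sumℤ n (λ r → val (A r c)) ≡ + 0 [mod modulus n k ]
    covers   : ∀ x → 1 ℕ.≤ x → x ℕ.≤ n ℕ.* k →
               ∃[ r ] ∃[ c ] (A r c ≡ just (+ x) ⊎ A r c ≡ just (- (+ x)))

-- cell (r,c) lies on diagonal D_d = {(i+d, i)}, i.e. r ≡ c + d (mod n)
OnDiag : ∀ {n} → Fin n → Cell n → Set
OnDiag {n} d (r , c) = (toℕ c ℕ.+ toℕ d ≡ toℕ r) ⊎ (toℕ c ℕ.+ toℕ d ≡ toℕ r ℕ.+ n)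

diffMod : (n : ℕ) → Fin n → Fin n → ℕ
diffMod n a b = if toℕ b ≤ᵇ toℕ a then toℕ a ∸ toℕ b else (toℕ a ℕ.+ n) ∸ toℕ b

prev : ∀ {k} → Fin k → Fin k
prev {suc k} zero    = fromℕ k
prev {suc k} (suc i) = inject₁ i

Odd : ℕ → Set
Odd k = ∃[ t ] k ≡ suc (2 ℕ.* t)

partialSum : (k : ℕ) → (Fin k → ℤ) → Fin k → ℤ
partialSum k a i = sumℤ k (λ j → if toℕ j ≤ᵇ toℕ i then a j else + 0)

SimpleSeq : (m k : ℕ) → (Fin k → ℤ) → Set
SimpleSeq m k a = ∀ i i' → partialSum k a i ≡ partialSum k a i' [mod m ] → i ≡ i'

GloballySimple : (n k : ℕ) → Array n → Set
GloballySimple n k A =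
  (∀ r c c' → Filled A (r , c) → Filled A (r , c') →
     sumℤ n (λ j → if toℕ j ≤ᵇ toℕ c  then val (A r j) else + 0)
       ≡ sumℤ n (λ j → if toℕ j ≤ᵇ toℕ c' then val (A r j) else + 0) [mod modulus n k ]
     → c ≡ c')
  ×
  (∀ c r r' → Filled A (r , c) → Filled A (r' , c) →
     sumℤ n (λ j → if toℕ j ≤ᵇ toℕ r  then val (A j c) else + 0)
       ≡ sumℤ n (λ j → if toℕ j ≤ᵇ toℕ r' then val (A j c) else + 0) [mod modulus n k ]
     → r ≡ r')

-- An ordering: for each row r a listing ρ r 0, …, ρ r (k-1) (cyclically) of the
-- columns of its filled cells, and for each column c a listing κ c 0, …, κ c (k-1)
-- of the rows of its filled cells.
record Ordering (n k : ℕ) (A : Array n) : Set where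
  field
    ρ : Fin n → Fin k → Fin n
    κ : Fin n → Fin k → Fin n
    ρ-filled : ∀ r j → Filled A (r , ρ r j)
    κ-filled : ∀ c j → Filled A (κ c j , c)
    ρ-inj : ∀ r j j' → ρ r j ≡ ρ r j' → j ≡ j'
    κ-inj : ∀ c j j' → κ c j ≡ κ c j' → j ≡ j'

module _ {n k : ℕ} {A : Array n} (O : Ordering n k A) where
  open Ordering O

  ωr : Cell n → Cell n → Set
  ωr (r , c) (r' , c') = (r ≡ r') × ∃[ j ] (ρ r (prev j) ≡ c × ρ r j ≡ c')

  ωc : Cell n → Cell n → Set
  ωc (r , c) (r' , c') = (c ≡ c') × ∃[ j ] (κ c (prev j) ≡ r × κ c j ≡ r')

  ωrc : Cell n → Cell n → Set
  ωrc x y = ∃[ z ] (ωc x z × ωr z y)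

  IsSimpleOrdering : Set
  IsSimpleOrdering =
    (∀ r → SimpleSeq (modulus n k) k (λ j → val (A r (ρ r j)))) ×
    (∀ c → SimpleSeq (modulus n k) k (λ j → val (A (κ c j) c)))

  -- ω_r ∘ ω_c is a single cycle on the set of (nk) filled cells:
  -- every filled cell is reached from every filled cell by iterating it.
  IsCompatible : Set
  IsCompatible = ∀ x y → Filled A x → Filled A y → Star ωrc x y

module Submission where

-- The ordering is explicit (DiagonalOrdering): row r lists its cells by
-- decreasing diagonal index, column c ≠ 0 by increasing index, and column 0
-- by decreasing index.  In each row and column the diagonals occur in the
-- natural order up to a cyclic rotation (ZMod: ⊕-cyclicLe, ⊖-cyclicLe), and
-- a rotation (Rotation) or reversal (Reversal) of a simple ordering with
-- total 0 is simple; this gives simplicity.  For compatibility, ω_r ∘ ω_c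
-- moves a cell of diagonal h in column c ≠ 0 by σ_h = g(h+1) - g(h) columns
-- along its diagonal and sends the cell in column 0 to diagonal h - 2.  As
-- σ_h is a unit of ℤ_n (ZMod.Multiples) and h ↦ h - 2 generates ℤ_k for odd
-- k (DoubleStep), every filled cell reaches every other one.

open import Defs
open import Data.Nat using (ℕ; zero; suc; _*_; _<_)
open import Data.Nat.GCD using (gcd)
open import Data.Fin as Fin using (Fin; toℕ)
open import Data.Product using (Σ; ∃; _×_; _,_; ∃-syntax; proj₁; proj₂)
open import Data.Sum using (_⊎_; inj₁; inj₂)
open import Data.Maybe using (Is-just)
open import Data.Bool using (Bool; true; false; if_then_else_; T)
open import Data.Unit using (tt)
open import Data.Empty using (⊥-elim)
open import Function.Bundles using (_⇔_)
open import Relation.Binary.PropositionalEquality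
  using (_≡_; refl; sym; trans; cong; cong₂; subst; subst₂; _≢_; module ≡-Reasoning)

T-ext : ∀ {b c : Bool} → (T b → T c) → (T c → T b) → b ≡ c
T-ext {true}  {true}  _ _ = refl
T-ext {true}  {false} f _ = ⊥-elim (f tt)
T-ext {false} {true}  _ g = ⊥-elim (g tt)
T-ext {false} {false} _ _ = refl

-- Partial sums in Defs select summands by
-- `_≤ᵇ_`, so we need to move between `_≤ᵇ_` and `_≤_` and to rewrite `_≤ᵇ_`
-- under the order-preserving (or reversing) maps used below.
module BoolOrder where
  open import Data.Nat using (zero; suc; _+_; _∸_; _≤_; _≤ᵇ_)
  import Data.Nat.Properties as ℕP

  ≤ᵇ-true⇒≤ : ∀ a b → (a ≤ᵇ b) ≡ true → a ≤ b
  ≤ᵇ-true⇒≤ a b eq = ℕP.≤ᵇ⇒≤ a b (subst T (sym eq) tt)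

  ≤ᵇ-false⇒> : ∀ a b → (a ≤ᵇ b) ≡ false → b < a
  ≤ᵇ-false⇒> a b eq = ℕP.≰⇒> (λ a≤b → subst T eq (ℕP.≤⇒≤ᵇ a≤b))

  ≤⇒≤ᵇ-true : ∀ {a b} → a ≤ b → (a ≤ᵇ b) ≡ true
  ≤⇒≤ᵇ-true a≤b = T-ext (λ _ → tt) (λ _ → ℕP.≤⇒≤ᵇ a≤b)

  >⇒≤ᵇ-false : ∀ {a b} → b < a → (a ≤ᵇ b) ≡ false
  >⇒≤ᵇ-false {a} {b} b<a = T-ext (λ t → ℕP.<⇒≱ b<a (ℕP.≤ᵇ⇒≤ a b t)) (λ ())

  ≤ᵇ-+-cancelˡ : ∀ c a b → (c + a ≤ᵇ c + b) ≡ (a ≤ᵇ b)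
  ≤ᵇ-+-cancelˡ c a b = T-ext
    (λ t → ℕP.≤⇒≤ᵇ (ℕP.+-cancelˡ-≤ c a b (ℕP.≤ᵇ⇒≤ _ _ t)))
    (λ t → ℕP.≤⇒≤ᵇ (ℕP.+-monoʳ-≤ c (ℕP.≤ᵇ⇒≤ a b t)))

  ≤ᵇ-∸-cancelʳ : ∀ {c} a b → c ≤ a → c ≤ b → (a ∸ c ≤ᵇ b ∸ c) ≡ (a ≤ᵇ b)
  ≤ᵇ-∸-cancelʳ {c} a b c≤a c≤b = T-ext
    (λ t → ℕP.≤⇒≤ᵇ (subst₂ _≤_ (ℕP.m∸n+n≡m c≤a) (ℕP.m∸n+n≡m c≤b)
                      (ℕP.+-monoˡ-≤ c (ℕP.≤ᵇ⇒≤ (a ∸ c) (b ∸ c) t))))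
    (λ t → ℕP.≤⇒≤ᵇ (ℕP.∸-monoˡ-≤ {a} {b} c (ℕP.≤ᵇ⇒≤ a b t)))

  ≤ᵇ-∸-flip : ∀ c a b → a ≤ c → b ≤ c → (c ∸ a ≤ᵇ c ∸ b) ≡ (b ≤ᵇ a)
  ≤ᵇ-∸-flip c a b a≤c b≤c = T-ext
    (λ t → ℕP.≤⇒≤ᵇ (ℕP.∸-cancelʳ-≤ b≤c (ℕP.≤ᵇ⇒≤ _ _ t)))
    (λ t → ℕP.≤⇒≤ᵇ (ℕP.∸-monoʳ-≤ {b} {a} c (ℕP.≤ᵇ⇒≤ b a t)))

  ≤ᵇ-suc : ∀ a b → (suc a ≤ᵇ suc b) ≡ (a ≤ᵇ b)
  ≤ᵇ-suc zero    b = refl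
  ≤ᵇ-suc (suc a) b = refl

module Sums where
  open import Data.Nat using (zero; suc; _≡ᵇ_)
  import Data.Nat.Properties as ℕP
  import Data.Fin.Properties as FinP
  open import Data.Integer using (ℤ; +_; _+_)
  import Data.Integer.Properties as ℤP
  open import Data.Integer.Tactic.RingSolver using (solve-∀)

  keep : Bool → ℤ → ℤ
  keep b x = if b then x else + 0

  keep-0 : ∀ b → keep b (+ 0) ≡ + 0
  keep-0 true  = refl
  keep-0 false = refl

  sum-cong : ∀ m {f g : Fin m → ℤ} → (∀ i → f i ≡ g i) → sumℤ m f ≡ sumℤ m g
  sum-cong zero    eq = refl
  sum-cong (suc m) eq = cong₂ _+_ (eq Fin.zero) (sum-cong m (λ i → eq (Fin.suc i)))

  sum-+ : ∀ m (f g : Fin m → ℤ) → sumℤ m (λ i → f i + g i) ≡ sumℤ m f + sumℤ m g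
  sum-+ zero    f g = refl
  sum-+ (suc m) f g =
    trans (cong (λ z → (f Fin.zero + g Fin.zero) + z) (sum-+ m (λ i → f (Fin.suc i)) (λ i → g (Fin.suc i))))
          (interchange (f Fin.zero) (g Fin.zero) _ _)
    where
    interchange : ∀ a b c d → (a + b) + (c + d) ≡ (a + c) + (b + d)
    interchange = solve-∀

  sum-zero : ∀ m (f : Fin m → ℤ) → (∀ i → f i ≡ + 0) → sumℤ m f ≡ + 0
  sum-zero zero    f eq = refl
  sum-zero (suc m) f eq = cong₂ _+_ (eq Fin.zero) (sum-zero m _ (λ i → eq (Fin.suc i)))

  sum-swap : ∀ m k (F : Fin m → Fin k → ℤ) →
    sumℤ m (λ i → sumℤ k (F i)) ≡ sumℤ k (λ j → sumℤ m (λ i → F i j))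
  sum-swap zero    k F = sym (sum-zero k _ (λ _ → refl))
  sum-swap (suc m) k F =
    trans (cong (λ z → sumℤ k (F Fin.zero) + z) (sum-swap m k (λ i → F (Fin.suc i))))
          (sym (sum-+ k (F Fin.zero) (λ j → sumℤ m (λ i → F (Fin.suc i) j))))

  sum-select : ∀ m (a : Fin m) (v : Fin m → ℤ) →
    sumℤ m (λ i → keep (toℕ i ≡ᵇ toℕ a) (v i)) ≡ v a
  sum-select (suc m) Fin.zero v =
    trans (cong (λ z → v Fin.zero + z) (sum-zero m _ (λ _ → refl))) (ℤP.+-identityʳ (v Fin.zero))
  sum-select (suc m) (Fin.suc a) v = trans (ℤP.+-identityˡ _) (sum-select m a (λ i → v (Fin.suc i)))

  sum-reindex : ∀ m k (e : Fin k → Fin m) → (∀ j j' → e j ≡ e j' → j ≡ j') →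
    (F : Fin m → ℤ) → (∀ c → F c ≡ + 0 ⊎ ∃[ j ] e j ≡ c) →
    sumℤ m F ≡ sumℤ k (λ j → F (e j))
  sum-reindex m k e e-inj F supp = begin
    sumℤ m F
      ≡⟨ sum-cong m spread ⟩
    sumℤ m (λ c → sumℤ k (λ j → keep (toℕ c ≡ᵇ toℕ (e j)) (F c)))
      ≡⟨ sum-swap m k _ ⟩
    sumℤ k (λ j → sumℤ m (λ c → keep (toℕ c ≡ᵇ toℕ (e j)) (F c)))
      ≡⟨ sum-cong k (λ j → sum-select m (e j) F) ⟩
    sumℤ k (λ j → F (e j)) ∎
    where
    open ≡-Reasoning
    hit⇔ : ∀ c j₀ → e j₀ ≡ c → ∀ j → (toℕ c ≡ᵇ toℕ (e j)) ≡ (toℕ j ≡ᵇ toℕ j₀)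
    hit⇔ c j₀ ej₀ j = T-ext
      (λ t → ℕP.≡⇒≡ᵇ _ _ (cong toℕ (e-inj j j₀ (sym (trans ej₀ (as-fin t))))))
      (λ t → ℕP.≡⇒≡ᵇ _ _ (cong toℕ (trans (sym ej₀) (cong e (sym (as-fin t))))))
      where
      as-fin : ∀ {l} {x y : Fin l} → T (toℕ x ≡ᵇ toℕ y) → x ≡ y
      as-fin t = FinP.toℕ-injective (ℕP.≡ᵇ⇒≡ _ _ t)
    spread : ∀ c → F c ≡ sumℤ k (λ j → keep (toℕ c ≡ᵇ toℕ (e j)) (F c))
    spread c with supp c
    ... | inj₁ Fc≡0 = trans Fc≡0 (sym (sum-zero k _ (λ j → trans (cong (keep _) Fc≡0) (keep-0 _))))
    ... | inj₂ (j₀ , ej₀) =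
      sym (trans (sum-cong k (λ j → cong (λ b → keep b (F c)) (hit⇔ c j₀ ej₀ j)))
                 (sum-select k j₀ (λ _ → F c)))

-- Each lemma is a linear consequence of its
-- hypotheses; it is proved through signed divisibility, which is closed
-- under sums, differences and negation.
module Congruence where
  open import Data.Integer using (ℤ; +_; -_; _-_; _+_)
  open import Data.Integer.Tactic.RingSolver using (solve-∀)
  open import Data.Integer.Divisibility.Signed
    using (∣ᵤ⇒∣; ∣⇒∣ᵤ; ∣m∣n⇒∣m+n; ∣m∣n⇒∣m-n; ∣m⇒∣-m; ∣-refl)
    renaming (_∣_ to _∣ˢ_)

  private
    along : ∀ {m} {u d : ℤ} → u ≡ d → m ∣ˢ u → m ∣ˢ d
    along {m} eq = subst (m ∣ˢ_) eq

    toˢ : ∀ {m} a b → a ≡ b [mod m ] → (+ m) ∣ˢ (a - b)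
    toˢ a b = ∣ᵤ⇒∣

    fromˢ : ∀ {m} a b → (+ m) ∣ˢ (a - b) → a ≡ b [mod m ]
    fromˢ a b = ∣⇒∣ᵤ

  ≡⇒≡[mod] : ∀ {m a b} → a ≡ b → a ≡ b [mod m ]
  ≡⇒≡[mod] {m} {a} refl = fromˢ a a (along (identity (+ m) a) (∣m∣n⇒∣m-n ∣-refl ∣-refl))
    where
    identity : ∀ m a → m - m ≡ a - a
    identity = solve-∀

  ≡-by-zero-shift : ∀ {m} a b t → a + t ≡ b → t ≡ + 0 [mod m ] → a ≡ b [mod m ]
  ≡-by-zero-shift a b t a+t≡b t≡0 =
    fromˢ a b (along (trans (identity a t) (cong (λ z → a - z) a+t≡b)) (∣m⇒∣-m (toˢ t (+ 0) t≡0)))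
    where
    identity : ∀ a t → - (t - + 0) ≡ a - (a + t)
    identity = solve-∀

  +-zero-closed : ∀ {m} x y → x ≡ + 0 [mod m ] → y ≡ + 0 [mod m ] → (x + y) ≡ + 0 [mod m ]
  +-zero-closed x y x≡0 y≡0 =
    fromˢ (x + y) (+ 0) (along (identity x y) (∣m∣n⇒∣m+n (toˢ x (+ 0) x≡0) (toˢ y (+ 0) y≡0)))
    where
    identity : ∀ x y → (x - + 0) + (y - + 0) ≡ (x + y) - + 0
    identity = solve-∀

  cancel-common : ∀ {m} a b y a' b' →
    a ≡ y + b [mod m ] → a' ≡ y + b' [mod m ] → a ≡ a' [mod m ] → b ≡ b' [mod m ]
  cancel-common a b y a' b' p q r =
    fromˢ b b' (along (identity a b y a' b')
      (∣m∣n⇒∣m+n (∣m∣n⇒∣m-n (toˢ a' (y + b') q) (toˢ a (y + b) p)) (toˢ a a' r)))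
    where
    identity : ∀ a b y a' b' → ((a' - (y + b')) - (a - (y + b))) + (a - a') ≡ b - b'
    identity = solve-∀

  complements : ∀ {m} x y x' y' →
    (x + y) ≡ + 0 [mod m ] → (x' + y') ≡ + 0 [mod m ] → x ≡ x' [mod m ] → y ≡ y' [mod m ]
  complements x y x' y' p q r =
    fromˢ y y' (along (identity x y x' y')
      (∣m∣n⇒∣m-n (∣m∣n⇒∣m-n (toˢ (x + y) (+ 0) p) (toˢ (x' + y') (+ 0) q)) (toˢ x x' r)))
    where
    identity : ∀ x y x' y' → (((x + y) - + 0) - ((x' + y') - + 0)) - (x - x') ≡ y - y'
    identity = solve-∀

-- The filled cells of a row (or column) of a
-- diagonal array, listed in the cyclic order that starts at some position s,
-- form a rotation of the natural left-to-right listing.  Because the whole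
-- row sums to 0, the partial sums of the rotation are the natural partial
-- sums shifted by a constant, so the rotation is simple when the natural
-- ordering is.
module Rotation where
  open import Data.Nat using (_≤_; _≤ᵇ_)
  import Data.Nat.Properties as ℕP
  open import Data.Bool using (_∧_; _∨_)
  open import Data.Integer using (ℤ; +_; _+_)
  import Data.Integer.Properties as ℤP
  open BoolOrder
  open Sums
  open Congruence

  -- a ≼ b in the cyclic order of positions s, s+1, …, then 0, 1, …, s-1
  cyclicLeᵇ : ℕ → ℕ → ℕ → Bool
  cyclicLeᵇ s a b = if s ≤ᵇ b then ((s ≤ᵇ a) ∧ (a ≤ᵇ b)) else ((s ≤ᵇ a) ∨ (a ≤ᵇ b))

  keep-∧ : ∀ b₁ b₂ x → b₁ ∨ b₂ ≡ true → keep b₁ x + keep b₂ x ≡ keep (b₁ ∧ b₂) x + x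
  keep-∧ true  true  x _ = refl
  keep-∧ true  false x _ = trans (ℤP.+-identityʳ x) (sym (ℤP.+-identityˡ x))
  keep-∧ false true  x _ = refl

  keep-∨ : ∀ b₁ b₂ x → b₁ ∧ b₂ ≡ false → keep (b₁ ∨ b₂) x ≡ keep b₁ x + keep b₂ x
  keep-∨ true  false x _ = sym (ℤP.+-identityʳ x)
  keep-∨ false true  x _ = sym (ℤP.+-identityˡ x)
  keep-∨ false false x _ = refl

  tail-or-prefix : ∀ {s c} a → s ≤ suc c → ((s ≤ᵇ a) ∨ (a ≤ᵇ c)) ≡ true
  tail-or-prefix {s} {c} a s≤1+c with s ≤ᵇ a in s≤ᵇa
  ... | true  = refl
  ... | false = ≤⇒≤ᵇ-true (ℕP.≤-pred (ℕP.<-≤-trans (≤ᵇ-false⇒> s a s≤ᵇa) s≤1+c))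

  tail-and-prefix : ∀ {s c} a → c < s → ((s ≤ᵇ a) ∧ (a ≤ᵇ c)) ≡ false
  tail-and-prefix {s} {c} a c<s with s ≤ᵇ a in s≤ᵇa
  ... | false = refl
  ... | true  = >⇒≤ᵇ-false (ℕP.<-≤-trans c<s (≤ᵇ-true⇒≤ s a s≤ᵇa))

  prefix : ∀ n → (Fin n → ℤ) → Fin n → ℤ
  prefix n f c = sumℤ n (λ j → keep (toℕ j ≤ᵇ toℕ c) (f j))

  tail : ∀ n → (Fin n → ℤ) → ℕ → ℤ
  tail n f s = sumℤ n (λ j → keep (s ≤ᵇ toℕ j) (f j))

  cyclicPrefix : ∀ n → (Fin n → ℤ) → ℕ → Fin n → ℤ
  cyclicPrefix n f s c = sumℤ n (λ j → keep (cyclicLeᵇ s (toℕ j) (toℕ c)) (f j))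

  rotated-prefix : ∀ {m} n (f : Fin n → ℤ) (s : ℕ) (c : Fin n) → sumℤ n f ≡ + 0 [mod m ] →
    cyclicPrefix n f s c ≡ tail n f s + prefix n f c [mod m ]
  rotated-prefix n f s c total with s ≤ᵇ toℕ c in s≤ᵇc
  -- s ≤ c: the tail and the prefix overlap in [s, c] and together cover everything once more
  ... | true = ≡-by-zero-shift (sumℤ n inside) (tail n f s + prefix n f c) (sumℤ n f)
        (trans (sym (sum-+ n inside f)) (trans (sym (sum-cong n split)) (sum-+ n _ _))) total
    where
    inside : Fin n → ℤ
    inside j = keep ((s ≤ᵇ toℕ j) ∧ (toℕ j ≤ᵇ toℕ c)) (f j)
    split : ∀ j → keep (s ≤ᵇ toℕ j) (f j) + keep (toℕ j ≤ᵇ toℕ c) (f j) ≡ inside j + f j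
    split j = keep-∧ (s ≤ᵇ toℕ j) (toℕ j ≤ᵇ toℕ c) (f j)
      (tail-or-prefix (toℕ j) (ℕP.m≤n⇒m≤1+n (≤ᵇ-true⇒≤ s (toℕ c) s≤ᵇc)))
  -- c < s: the cyclic prefix is the disjoint union of the tail and the prefix
  ... | false = ≡⇒≡[mod] (trans (sum-cong n split) (sum-+ n _ _))
    where
    split : ∀ j → keep ((s ≤ᵇ toℕ j) ∨ (toℕ j ≤ᵇ toℕ c)) (f j)
                ≡ keep (s ≤ᵇ toℕ j) (f j) + keep (toℕ j ≤ᵇ toℕ c) (f j)
    split j = keep-∨ (s ≤ᵇ toℕ j) (toℕ j ≤ᵇ toℕ c) (f j)
      (tail-and-prefix (toℕ j) (≤ᵇ-false⇒> s (toℕ c) s≤ᵇc))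

  rotation-simple : ∀ {m} n k (f : Fin n → ℤ) (e : Fin k → Fin n) (s : ℕ) →
    (∀ j j' → e j ≡ e j' → j ≡ j') →
    (∀ c → f c ≡ + 0 ⊎ ∃[ j ] e j ≡ c) →
    (∀ i j → (toℕ j ≤ᵇ toℕ i) ≡ cyclicLeᵇ s (toℕ (e j)) (toℕ (e i))) →
    sumℤ n f ≡ + 0 [mod m ] →
    (∀ i i' → prefix n f (e i) ≡ prefix n f (e i') [mod m ] → e i ≡ e i') →
    SimpleSeq m k (λ j → f (e j))
  rotation-simple {m} n k f e s e-inj supp follows total natural i i' eq =
    e-inj i i' (natural i i' (cancel-common (rotated i) _ (tail n f s) (rotated i') _
      (rotated-prefix n f s (e i) total) (rotated-prefix n f s (e i') total)
      (subst₂ (λ a b → a ≡ b [mod m ]) (listed i) (listed i') eq)))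
    where
    rotated : Fin k → ℤ
    rotated i = cyclicPrefix n f s (e i)
    masked-supp : ∀ i c → keep (cyclicLeᵇ s (toℕ c) (toℕ (e i))) (f c) ≡ + 0 ⊎ ∃[ j ] e j ≡ c
    masked-supp i c with supp c
    ... | inj₁ fc≡0 = inj₁ (trans (cong (keep _) fc≡0) (keep-0 _))
    ... | inj₂ hit  = inj₂ hit
    listed : ∀ i → partialSum k (λ j → f (e j)) i ≡ rotated i
    listed i = trans (sum-cong k (λ j → cong (λ b → keep b (f (e j))) (follows i j)))
                     (sym (sum-reindex n k e e-inj _ (masked-supp i)))

module Residues (N : ℕ) .{{_ : Data.Nat.NonZero N}} where
  open import Data.Nat using (suc; _+_; _*_; _∸_; _%_; _/_)
  import Data.Nat.Properties as ℕP
  open import Data.Nat.DivMod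
  open import Data.Nat.Tactic.RingSolver using (solve-∀)
  import Data.Fin.Properties as FinP

  %-cong-+ : ∀ {x x' y y'} → x % N ≡ x' % N → y % N ≡ y' % N → (x + y) % N ≡ (x' + y') % N
  %-cong-+ {x} {x'} {y} {y'} p q =
    trans (%-distribˡ-+ x y N) (trans (cong₂ (λ a b → (a + b) % N) p q) (sym (%-distribˡ-+ x' y' N)))

  %-cong-* : ∀ {x x' y y'} → x % N ≡ x' % N → y % N ≡ y' % N → (x * y) % N ≡ (x' * y') % N
  %-cong-* {x} {x'} {y} {y'} p q =
    trans (%-distribˡ-* x y N) (trans (cong₂ (λ a b → (a * b) % N) p q) (sym (%-distribˡ-* x' y' N)))

  %-idem : ∀ x → (x % N) % N ≡ x % N
  %-idem x = m%n%n≡m%n x N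

  +-undo-% : ∀ x b → (x + b + (N ∸ b % N)) % N ≡ x % N
  +-undo-% x b = trans (cong (_% N) rearranged) ([m+kn]%n≡m%n x (suc (b / N)) N)
    where
    shuffle : ∀ x r q w n → x + (r + q * n) + w ≡ x + (r + w) + q * n
    shuffle = solve-∀
    rearranged : x + b + (N ∸ b % N) ≡ x + suc (b / N) * N
    rearranged = begin
      x + b + (N ∸ b % N)                   ≡⟨ cong (λ z → x + z + (N ∸ b % N)) (m≡m%n+[m/n]*n b N) ⟩
      x + (b % N + b / N * N) + (N ∸ b % N) ≡⟨ shuffle x (b % N) (b / N) (N ∸ b % N) N ⟩
      x + (b % N + (N ∸ b % N)) + b / N * N ≡⟨ cong (λ z → x + z + b / N * N)
                                                    (ℕP.m+[n∸m]≡n (m%n≤n b N)) ⟩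
      x + N + b / N * N                     ≡⟨ ℕP.+-assoc x N (b / N * N) ⟩
      x + suc (b / N) * N                   ∎
      where open ≡-Reasoning

  +-cancelʳ-% : ∀ x y b → (x + b) % N ≡ (y + b) % N → x % N ≡ y % N
  +-cancelʳ-% x y b eq =
    trans (sym (+-undo-% x b)) (trans (%-cong-+ {x + b} {y + b} {N ∸ b % N} eq refl) (+-undo-% y b))

  fin-≡-% : ∀ (a b : Fin N) → toℕ a % N ≡ toℕ b % N → a ≡ b
  fin-≡-% a b eq = FinP.toℕ-injective
    (trans (sym (m<n⇒m%n≡m (FinP.toℕ<n a))) (trans eq (m<n⇒m%n≡m (FinP.toℕ<n b))))

-- Translation c ↦ c ⊕ a carries the natural
-- order of Fin N to the cyclic order starting at c, and r ↦ r ⊖ a reverses it.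
module ZMod (n' : ℕ) where
  open import Data.Nat using (zero; suc; _+_; _*_; _∸_; _%_; _≤_; _≤ᵇ_; z≤n; s≤s)
  import Data.Nat.Properties as ℕP
  open import Data.Nat.DivMod
    using (m%n<n; [m+n]%n≡m%n; [m+kn]%n≡m%n; m*n%n≡0; n%n≡0; m<n⇒m%n≡m; m≤n⇒[n∸m]%m≡n%m)
  open import Data.Nat.Divisibility using (_∣_; ∣⇒≤; m%n≡0⇒n∣m)
  open import Data.Nat.GCD using (module Bézout)
  open import Data.Nat.Coprimality using (Coprime; coprime-divisor; coprime-Bézout)
  open import Data.Nat.Tactic.RingSolver using (solve-∀)
  import Data.Fin.Properties as FinP
  open BoolOrder
  open Rotation using (cyclicLeᵇ)

  N : ℕ
  N = suc n'

  open Residues N public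

  res : ℕ → Fin N
  res x = Fin.fromℕ< (m%n<n x N)

  toℕ-res : ∀ x → toℕ (res x) ≡ x % N
  toℕ-res x = FinP.toℕ-fromℕ< (m%n<n x N)

  toℕ-res-% : ∀ x → toℕ (res x) % N ≡ x % N
  toℕ-res-% x = trans (cong (_% N) (toℕ-res x)) (%-idem x)

  res-cong : ∀ x y → x % N ≡ y % N → res x ≡ res y
  res-cong x y eq = fin-≡-% _ _ (trans (toℕ-res-% x) (trans eq (sym (toℕ-res-% y))))

  _⊕_ : Fin N → Fin N → Fin N
  c ⊕ d = res (toℕ c + toℕ d)

  ⊕-cases : ∀ (c a : Fin N) → (toℕ c + toℕ a < N × toℕ (c ⊕ a) ≡ toℕ c + toℕ a)
                            ⊎ (N ≤ toℕ c + toℕ a × toℕ (c ⊕ a) ≡ toℕ c + toℕ a ∸ N)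
  ⊕-cases c a with ℕP.<-≤-connex (toℕ c + toℕ a) N
  ... | inj₁ lt = inj₁ (lt , trans (toℕ-res (toℕ c + toℕ a)) (m<n⇒m%n≡m lt))
  ... | inj₂ ge = inj₂ (ge , trans (toℕ-res (toℕ c + toℕ a))
          (trans (sym (m≤n⇒[n∸m]%m≡n%m ge)) (m<n⇒m%n≡m wrapped)))
    where
    wrapped : toℕ c + toℕ a ∸ N < N
    wrapped = subst (toℕ c + toℕ a ∸ N <_) (ℕP.m+n∸n≡m N N)
                (ℕP.∸-monoˡ-< (ℕP.+-mono-< (FinP.toℕ<n c) (FinP.toℕ<n a)) ge)

  ⊕-injʳ : ∀ c a b → c ⊕ a ≡ c ⊕ b → a ≡ b
  ⊕-injʳ c a b eq = fin-≡-% a b (+-cancelʳ-% (toℕ a) (toℕ b) (toℕ c) (begin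
    (toℕ a + toℕ c) % N   ≡⟨ cong (_% N) (ℕP.+-comm (toℕ a) (toℕ c)) ⟩
    (toℕ c + toℕ a) % N   ≡⟨ sym (toℕ-res (toℕ c + toℕ a)) ⟩
    toℕ (c ⊕ a)           ≡⟨ cong toℕ eq ⟩
    toℕ (c ⊕ b)           ≡⟨ toℕ-res (toℕ c + toℕ b) ⟩
    (toℕ c + toℕ b) % N   ≡⟨ cong (_% N) (ℕP.+-comm (toℕ c) (toℕ b)) ⟩
    (toℕ b + toℕ c) % N   ∎))
    where open ≡-Reasoning

  diffMod-cases : ∀ (r d : Fin N) → (toℕ d ≤ toℕ r × diffMod N r d ≡ toℕ r ∸ toℕ d)
                                  ⊎ (toℕ r < toℕ d × diffMod N r d ≡ toℕ r + N ∸ toℕ d)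
  diffMod-cases r d with toℕ d ≤ᵇ toℕ r in eq
  ... | true  = inj₁ (≤ᵇ-true⇒≤ _ _ eq , refl)
  ... | false = inj₂ (≤ᵇ-false⇒> _ _ eq , refl)

  private
    d≤r+N : ∀ (r d : Fin N) → toℕ d ≤ toℕ r + N
    d≤r+N r d = ℕP.≤-trans (ℕP.<⇒≤ (FinP.toℕ<n d)) (ℕP.m≤n+m N (toℕ r))

  diffMod<N : ∀ (r d : Fin N) → diffMod N r d < N
  diffMod<N r d with diffMod-cases r d
  ... | inj₁ (_ , eq) rewrite eq = ℕP.≤-<-trans (ℕP.m∸n≤m (toℕ r) (toℕ d)) (FinP.toℕ<n r)
  ... | inj₂ (lt , eq) rewrite eq = ℕP.+-cancelˡ-< (toℕ d) _ _
          (subst (_< toℕ d + N) (sym (ℕP.m+[n∸m]≡n (d≤r+N r d))) (ℕP.+-monoˡ-< N lt))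

  diffMod-+ : ∀ (r d : Fin N) →
    (diffMod N r d + toℕ d ≡ toℕ r) ⊎ (diffMod N r d + toℕ d ≡ toℕ r + N)
  diffMod-+ r d with diffMod-cases r d
  ... | inj₁ (le , eq) rewrite eq = inj₁ (ℕP.m∸n+n≡m le)
  ... | inj₂ (_ , eq) rewrite eq = inj₂ (ℕP.m∸n+n≡m (d≤r+N r d))

  diffMod-% : ∀ (r d : Fin N) → (diffMod N r d + toℕ d) % N ≡ toℕ r % N
  diffMod-% r d with diffMod-+ r d
  ... | inj₁ eq = cong (_% N) eq
  ... | inj₂ eq = trans (cong (_% N) eq) ([m+n]%n≡m%n (toℕ r) N)

  _⊖_ : Fin N → Fin N → Fin N
  r ⊖ d = Fin.fromℕ< (diffMod<N r d)

  toℕ-⊖ : ∀ r d → toℕ (r ⊖ d) ≡ diffMod N r d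
  toℕ-⊖ r d = FinP.toℕ-fromℕ< (diffMod<N r d)

  ⊖-injʳ : ∀ r a b → r ⊖ a ≡ r ⊖ b → a ≡ b
  ⊖-injʳ r a b eq = fin-≡-% a b (+-cancelʳ-% (toℕ a) (toℕ b) (diffMod N r a) (begin
    (toℕ a + diffMod N r a) % N ≡⟨ cong (_% N) (ℕP.+-comm (toℕ a) _) ⟩
    (diffMod N r a + toℕ a) % N ≡⟨ diffMod-% r a ⟩
    toℕ r % N                   ≡⟨ sym (diffMod-% r b) ⟩
    (diffMod N r b + toℕ b) % N ≡⟨ cong (_% N) (ℕP.+-comm (diffMod N r b) (toℕ b)) ⟩
    (toℕ b + diffMod N r b) % N ≡⟨ cong (λ z → (toℕ b + z) % N) (sym same) ⟩
    (toℕ b + diffMod N r a) % N ∎))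
    where
    open ≡-Reasoning
    same : diffMod N r a ≡ diffMod N r b
    same = trans (sym (toℕ-⊖ r a)) (trans (cong toℕ eq) (toℕ-⊖ r b))

  ⊕-⊖-% : ∀ c a b → toℕ ((c ⊕ a) ⊖ b) % N ≡ (toℕ c + diffMod N a b) % N
  ⊕-⊖-% c a b rewrite toℕ-⊖ (c ⊕ a) b =
    +-cancelʳ-% (diffMod N (c ⊕ a) b) (toℕ c + diffMod N a b) (toℕ b) (begin
      (diffMod N (c ⊕ a) b + toℕ b) % N ≡⟨ diffMod-% (c ⊕ a) b ⟩
      toℕ (c ⊕ a) % N                  ≡⟨ cong (_% N) (toℕ-res (toℕ c + toℕ a)) ⟩
      (toℕ c + toℕ a) % N % N          ≡⟨ %-idem (toℕ c + toℕ a) ⟩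
      (toℕ c + toℕ a) % N              ≡⟨ %-cong-+ {toℕ c} {toℕ c} refl (sym (diffMod-% a b)) ⟩
      (toℕ c + (diffMod N a b + toℕ b)) % N ≡⟨ cong (_% N)
                                                 (sym (ℕP.+-assoc (toℕ c) (diffMod N a b) (toℕ b))) ⟩
      (toℕ c + diffMod N a b + toℕ b) % N ∎)
    where open ≡-Reasoning

  ⊕-⊖-cancel : ∀ c d → (c ⊕ d) ⊖ d ≡ c
  ⊕-⊖-cancel c d = fin-≡-% _ _ (trans (⊕-⊖-% c d d)
    (trans (cong (λ z → (toℕ c + z) % N) (diffMod-self d)) (cong (_% N) (ℕP.+-identityʳ (toℕ c)))))
    where
    diffMod-self : ∀ d → diffMod N d d ≡ 0
    diffMod-self d rewrite ≤⇒≤ᵇ-true (ℕP.≤-refl {toℕ d}) = ℕP.n∸n≡0 (toℕ d)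

  onDiag-% : ∀ d r c → OnDiag d (r , c) → (toℕ c + toℕ d) % N ≡ toℕ r % N
  onDiag-% d r c (inj₁ eq) = cong (_% N) eq
  onDiag-% d r c (inj₂ eq) = trans (cong (_% N) eq) ([m+n]%n≡m%n (toℕ r) N)

  onDiag⇒row : ∀ d r c → OnDiag d (r , c) → r ≡ c ⊕ d
  onDiag⇒row d r c on = fin-≡-% _ _ (begin
    toℕ r % N                    ≡⟨ sym (onDiag-% d r c on) ⟩
    (toℕ c + toℕ d) % N          ≡⟨ sym (%-idem (toℕ c + toℕ d)) ⟩
    (toℕ c + toℕ d) % N % N      ≡⟨ cong (_% N) (sym (toℕ-res (toℕ c + toℕ d))) ⟩
    toℕ (c ⊕ d) % N              ∎)
    where open ≡-Reasoning

  onDiag⇒col : ∀ d r c → OnDiag d (r , c) → c ≡ r ⊖ d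
  onDiag⇒col d r c on = fin-≡-% _ _ (+-cancelʳ-% (toℕ c) (toℕ (r ⊖ d)) (toℕ d)
    (trans (onDiag-% d r c on)
           (sym (trans (cong (λ z → (z + toℕ d) % N) (toℕ-⊖ r d)) (diffMod-% r d)))))

  onDiag-⊕ : ∀ d c → OnDiag d (c ⊕ d , c)
  onDiag-⊕ d c with ⊕-cases c d
  ... | inj₁ (_ , eq)  = inj₁ (sym eq)
  ... | inj₂ (ge , eq) = inj₂ (sym (trans (cong (_+ N) eq) (ℕP.m∸n+n≡m ge)))

  onDiag-⊖ : ∀ r d → OnDiag d (r , r ⊖ d)
  onDiag-⊖ r d rewrite toℕ-⊖ r d with diffMod-+ r d
  ... | inj₁ eq = inj₁ eq
  ... | inj₂ eq = inj₂ eq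

  private
    wrapped-below : ∀ (c a : Fin N) → N ≤ toℕ c + toℕ a → toℕ c + toℕ a ∸ N < toℕ c
    wrapped-below c a ge = subst (toℕ c + toℕ a ∸ N <_) (ℕP.m+n∸n≡m (toℕ c) N)
      (ℕP.∸-monoˡ-< (ℕP.+-monoʳ-< (toℕ c) (FinP.toℕ<n a)) ge)

    unwrapped-below : ∀ (r d : Fin N) → toℕ r ∸ toℕ d < suc (toℕ r)
    unwrapped-below r d = s≤s (ℕP.m∸n≤m (toℕ r) (toℕ d))

    wrapped-above : ∀ R (d : Fin N) → suc R ≤ R + N ∸ toℕ d
    wrapped-above R d = subst₂ _≤_ (ℕP.+-comm R 1) (sym (ℕP.+-∸-assoc R (ℕP.<⇒≤ (FinP.toℕ<n d))))
                          (ℕP.+-monoʳ-≤ R (ℕP.m<n⇒0<n∸m (FinP.toℕ<n d)))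

  ⊕-cyclicLe : ∀ c a b → cyclicLeᵇ (toℕ c) (toℕ (c ⊕ a)) (toℕ (c ⊕ b)) ≡ (toℕ a ≤ᵇ toℕ b)
  ⊕-cyclicLe c a b with ⊕-cases c a | ⊕-cases c b
  ... | inj₁ (la , ea) | inj₁ (lb , eb) rewrite ea | eb
      | ≤⇒≤ᵇ-true (ℕP.m≤m+n (toℕ c) (toℕ a)) | ≤⇒≤ᵇ-true (ℕP.m≤m+n (toℕ c) (toℕ b)) =
        ≤ᵇ-+-cancelˡ (toℕ c) (toℕ a) (toℕ b)
  ... | inj₁ (la , ea) | inj₂ (lb , eb) rewrite ea | eb
      | ≤⇒≤ᵇ-true (ℕP.m≤m+n (toℕ c) (toℕ a)) | >⇒≤ᵇ-false (wrapped-below c b lb) =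
        sym (≤⇒≤ᵇ-true (ℕP.<⇒≤ (ℕP.+-cancelˡ-< (toℕ c) (toℕ a) (toℕ b)
                                                (ℕP.<-≤-trans la lb))))
  ... | inj₂ (la , ea) | inj₁ (lb , eb) rewrite ea | eb
      | >⇒≤ᵇ-false (wrapped-below c a la) | ≤⇒≤ᵇ-true (ℕP.m≤m+n (toℕ c) (toℕ b)) =
        sym (>⇒≤ᵇ-false (ℕP.+-cancelˡ-< (toℕ c) (toℕ b) (toℕ a) (ℕP.<-≤-trans lb la)))
  ... | inj₂ (la , ea) | inj₂ (lb , eb) rewrite ea | eb
      | >⇒≤ᵇ-false (wrapped-below c a la) | >⇒≤ᵇ-false (wrapped-below c b lb) =
        trans (≤ᵇ-∸-cancelʳ _ _ la lb) (≤ᵇ-+-cancelˡ (toℕ c) (toℕ a) (toℕ b))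

  ⊖-cyclicLe : ∀ r a b →
    cyclicLeᵇ (suc (toℕ r)) (toℕ (r ⊖ a)) (toℕ (r ⊖ b)) ≡ (toℕ b ≤ᵇ toℕ a)
  ⊖-cyclicLe r a b rewrite toℕ-⊖ r a | toℕ-⊖ r b with diffMod-cases r a | diffMod-cases r b
  ... | inj₁ (la , ea) | inj₁ (lb , eb) rewrite ea | eb
      | >⇒≤ᵇ-false (unwrapped-below r a) | >⇒≤ᵇ-false (unwrapped-below r b) =
        ≤ᵇ-∸-flip (toℕ r) (toℕ a) (toℕ b) la lb
  ... | inj₁ (la , ea) | inj₂ (lb , eb) rewrite ea | eb
      | >⇒≤ᵇ-false (unwrapped-below r a) | ≤⇒≤ᵇ-true (wrapped-above (toℕ r) b) =
        sym (>⇒≤ᵇ-false (ℕP.≤-<-trans la lb))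
  ... | inj₂ (la , ea) | inj₁ (lb , eb) rewrite ea | eb
      | ≤⇒≤ᵇ-true (wrapped-above (toℕ r) a) | >⇒≤ᵇ-false (unwrapped-below r b) =
        sym (≤⇒≤ᵇ-true (ℕP.<⇒≤ (ℕP.≤-<-trans lb la)))
  ... | inj₂ (la , ea) | inj₂ (lb , eb) rewrite ea | eb
      | ≤⇒≤ᵇ-true (wrapped-above (toℕ r) a) | ≤⇒≤ᵇ-true (wrapped-above (toℕ r) b) =
        ≤ᵇ-∸-flip (toℕ r + N) (toℕ a) (toℕ b) (d≤r+N r a) (d≤r+N r b)

  ⊖-⊕-cancel : ∀ r d → (r ⊖ d) ⊕ d ≡ r
  ⊖-⊕-cancel r d = sym (onDiag⇒row d r (r ⊖ d) (onDiag-⊖ r d))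

  -- going down diagonal a from column c and back up diagonal b shifts the column by a - b
  ⊕-⊖-shift : ∀ c a b → (c ⊕ a) ⊖ b ≡ res (toℕ c + diffMod N a b)
  ⊕-⊖-shift c a b = fin-≡-% _ _ (trans (⊕-⊖-% c a b)
    (sym (toℕ-res-% (toℕ c + diffMod N a b))))

  ⊕-shift : ∀ c a b → c ⊕ a ≡ res (toℕ c + diffMod N a b) ⊕ b
  ⊕-shift c a b = trans (sym (⊖-⊕-cancel (c ⊕ a) b)) (cong (_⊕ b) (⊕-⊖-shift c a b))

  N·s≡0 : ∀ s → (N * s) % N ≡ 0
  N·s≡0 s = trans (cong (_% N) (ℕP.*-comm N s)) (m*n%n≡0 s N)

  module Multiples (s : ℕ) (coprime : Coprime N s) where

    multiple-≢0 : ∀ u → 1 ≤ u → u < N → (u * s) % N ≢ 0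
    multiple-≢0 (suc u) _ u<N us≡0 = ℕP.<⇒≱ u<N (∣⇒≤ (coprime-divisor coprime
      (subst (N ∣_) (ℕP.*-comm (suc u) s) (m%n≡0⇒n∣m (suc u * s) N us≡0))))

    inverse : ∃[ v ] (v * s) % N ≡ 1 % N
    inverse with coprime-Bézout coprime
    ... | Bézout.-+ x y eq = y , trans (cong (_% N) (sym eq)) ([m+kn]%n≡m%n 1 x N)
    ... | Bézout.+- x y eq = n' * y , +-cancelʳ-% (n' * y * s) 1 n' (begin
      (n' * y * s + n') % N   ≡⟨ cong (_% N) (distribute n' y s) ⟩
      n' * (1 + y * s) % N    ≡⟨ cong (λ z → n' * z % N) eq ⟩
      n' * (x * N) % N        ≡⟨ cong (_% N) (sym (ℕP.*-assoc n' x N)) ⟩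
      n' * x * N % N          ≡⟨ m*n%n≡0 (n' * x) N ⟩
      0                       ≡⟨ sym (n%n≡0 N) ⟩
      (1 + n') % N            ∎)
      where
      open ≡-Reasoning
      distribute : ∀ w y s → w * y * s + w ≡ w * (1 + y * s)
      distribute = solve-∀

    every-residue : ∀ (c : Fin N) → ∃[ u ] (1 ≤ u × u ≤ N × res (u * s) ≡ c)
    every-residue c with inverse
    ... | v , vs≡1 = choose ((toℕ c * v) % N) refl
      where
      solves : ((toℕ c * v) % N * s) % N ≡ toℕ c % N
      solves = begin
        ((toℕ c * v) % N * s) % N ≡⟨ %-cong-* {(toℕ c * v) % N} {toℕ c * v} {s} {s}
                                      (%-idem (toℕ c * v)) refl ⟩
        (toℕ c * v * s) % N       ≡⟨ cong (_% N) (ℕP.*-assoc (toℕ c) v s) ⟩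
        (toℕ c * (v * s)) % N     ≡⟨ %-cong-* {toℕ c} {toℕ c} {v * s} {1} refl vs≡1 ⟩
        (toℕ c * 1) % N           ≡⟨ cong (_% N) (ℕP.*-identityʳ (toℕ c)) ⟩
        toℕ c % N                 ∎
        where open ≡-Reasoning
      -- the representative 0 of c·v is replaced by N
      choose : ∀ u → (toℕ c * v) % N ≡ u → ∃[ u ] (1 ≤ u × u ≤ N × res (u * s) ≡ c)
      choose zero eq = N , s≤s z≤n , ℕP.≤-refl , fin-≡-% _ _ (begin
        toℕ (res (N * s)) % N     ≡⟨ toℕ-res-% (N * s) ⟩
        (N * s) % N               ≡⟨ N·s≡0 s ⟩
        0                         ≡⟨ cong (λ z → (z * s) % N) (sym eq) ⟩
        ((toℕ c * v) % N * s) % N ≡⟨ solves ⟩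
        toℕ c % N                 ∎)
        where open ≡-Reasoning
      choose (suc u) eq = suc u , s≤s z≤n , subst (_≤ N) eq (ℕP.<⇒≤ (m%n<n (toℕ c * v) N)) ,
        fin-≡-% _ _ (trans (toℕ-res-% (suc u * s)) (trans (cong (λ z → (z * s) % N) (sym eq)) solves))

module CyclicFin (k' : ℕ) where
  open import Data.Nat using (suc; _+_; _∸_; _%_; _≤ᵇ_)
  import Data.Nat.Properties as ℕP
  open import Data.Nat.DivMod using (n%n≡0)
  import Data.Fin.Properties as FinP
  open BoolOrder

  K : ℕ
  K = suc k'

  open Residues K

  toℕ-prev-zero : toℕ (prev {K} Fin.zero) ≡ k'
  toℕ-prev-zero = FinP.toℕ-fromℕ k'

  opp : Fin K → Fin K
  opp = Fin.opposite

  opp-involutive : ∀ x → opp (opp x) ≡ x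
  opp-involutive = FinP.opposite-involutive

  opp-injective : ∀ x y → opp x ≡ opp y → x ≡ y
  opp-injective x y eq = trans (sym (opp-involutive x)) (trans (cong opp eq) (opp-involutive y))

  opp-≤ᵇ : ∀ x y → (toℕ (opp x) ≤ᵇ toℕ (opp y)) ≡ (toℕ y ≤ᵇ toℕ x)
  opp-≤ᵇ x y rewrite FinP.opposite-prop x | FinP.opposite-prop y =
    trans (≤ᵇ-∸-flip K (suc (toℕ x)) (suc (toℕ y)) (FinP.toℕ<n x) (FinP.toℕ<n y))
          (≤ᵇ-suc (toℕ y) (toℕ x))

  -- `opp ∘ prev` is the reflection j ↦ -j of ℤ_K, hence an involution
  reflect : Fin K → Fin K
  reflect x = opp (prev x)

  reflect-% : ∀ x → (toℕ (reflect x) + toℕ x) % K ≡ 0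
  reflect-% Fin.zero rewrite FinP.opposite-prop (prev {K} Fin.zero) | toℕ-prev-zero | ℕP.n∸n≡0 k' = refl
  reflect-% (Fin.suc y) rewrite FinP.opposite-prop (Fin.inject₁ y) | FinP.toℕ-inject₁ y
    | ℕP.+-suc (k' ∸ toℕ y) (toℕ y) | ℕP.m∸n+n≡m (ℕP.<⇒≤ (FinP.toℕ<n y)) = n%n≡0 K

  reflect-involutive : ∀ x → reflect (reflect x) ≡ x
  reflect-involutive x = fin-≡-% _ _ (+-cancelʳ-% (toℕ (reflect (reflect x))) (toℕ x) (toℕ (reflect x))
    (trans (reflect-% (reflect x))
      (trans (sym (reflect-% x)) (cong (_% K) (ℕP.+-comm (toℕ (reflect x)) (toℕ x))))))

  prev-injective : ∀ x y → prev x ≡ prev y → x ≡ y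
  prev-injective x y eq =
    trans (sym (reflect-involutive x)) (trans (cong reflect (cong opp eq)) (reflect-involutive y))

  next : Fin K → Fin K
  next x = opp (prev (opp x))

  next-prev : ∀ x → next (prev x) ≡ x
  next-prev = reflect-involutive

  prev-next : ∀ x → prev (next x) ≡ x
  prev-next x = opp-injective _ _ (reflect-involutive (opp x))

-- Reversing an ordering with total 0 preserves simplicity: the i-th partial
-- sum of the reversed sequence is the suffix of the original from opp i,
-- the complement of the original prefix up to prev (opp i).
module Reversal (k' : ℕ) where
  open import Data.Nat using (suc; _≤_; _≤ᵇ_)
  import Data.Nat.Properties as ℕP
  import Data.Fin.Properties as FinP
  open import Data.Integer using (ℤ; +_; _+_)
  open BoolOrder
  open Sums
  open Congruence
  open Rotation using (tail; keep-∨; tail-or-prefix; tail-and-prefix)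
  open CyclicFin k'

  suffix+prefix : ∀ {m} (a : Fin K → ℤ) → sumℤ K a ≡ + 0 [mod m ] →
    ∀ t → (tail K a (toℕ t) + partialSum K a (prev t)) ≡ + 0 [mod m ]
  -- before 0 lies (cyclically) the whole sequence: both terms are the total
  suffix+prefix a total Fin.zero =
    +-zero-closed (tail K a 0) (partialSum K a (prev Fin.zero)) total
      (subst (λ z → z ≡ + 0 [mod _ ]) (sum-cong K everything) total)
    where
    everything : ∀ c → a c ≡ keep (toℕ c ≤ᵇ toℕ (prev {K} Fin.zero)) (a c)
    everything c = cong (λ b → keep b (a c))
      (sym (≤⇒≤ᵇ-true (subst (toℕ c ≤_) (sym toℕ-prev-zero) (ℕP.≤-pred (FinP.toℕ<n c)))))
  -- before t + 1 lies [0, t]: the two sums split the total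
  suffix+prefix a total (Fin.suc t) =
    subst (λ z → z ≡ + 0 [mod _ ]) (trans (sum-cong K split) (sum-+ K later earlier)) total
    where
    later earlier : Fin K → ℤ
    later c = keep (suc (toℕ t) ≤ᵇ toℕ c) (a c)
    earlier c = keep (toℕ c ≤ᵇ toℕ (Fin.inject₁ t)) (a c)
    split : ∀ c → a c ≡ later c + earlier c
    split c rewrite FinP.toℕ-inject₁ t =
      trans (cong (λ b → keep b (a c)) (sym (tail-or-prefix (toℕ c) ℕP.≤-refl)))
            (keep-∨ (suc (toℕ t) ≤ᵇ toℕ c) (toℕ c ≤ᵇ toℕ t) (a c)
                    (tail-and-prefix (toℕ c) (ℕP.n<1+n (toℕ t))))

  reversed-partialSum : ∀ (a : Fin K → ℤ) i →
    partialSum K (λ j → a (opp j)) i ≡ tail K a (toℕ (opp i))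
  reversed-partialSum a i = begin
    sumℤ K (λ j → keep (toℕ j ≤ᵇ toℕ i) (a (opp j)))
      ≡⟨ sum-cong K (λ j → cong (λ z → keep (toℕ z ≤ᵇ toℕ i) (a (opp j)))
                               (sym (opp-involutive j))) ⟩
    sumℤ K (λ j → F (opp j))
      ≡⟨ sym (sum-reindex K K opp opp-injective F (λ c → inj₂ (opp c , opp-involutive c))) ⟩
    sumℤ K F
      ≡⟨ sum-cong K (λ c → cong (λ b → keep b (a c)) (flip c)) ⟩
    tail K a (toℕ (opp i)) ∎
    where
    open ≡-Reasoning
    F : Fin K → ℤ
    F c = keep (toℕ (opp c) ≤ᵇ toℕ i) (a c)
    flip : ∀ c → (toℕ (opp c) ≤ᵇ toℕ i) ≡ (toℕ (opp i) ≤ᵇ toℕ c)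
    flip c = trans (cong (λ z → toℕ (opp c) ≤ᵇ toℕ z) (sym (opp-involutive i))) (opp-≤ᵇ c (opp i))

  reversal-simple : ∀ m (a : Fin K → ℤ) → sumℤ K a ≡ + 0 [mod m ] →
    SimpleSeq m K a → SimpleSeq m K (λ j → a (opp j))
  reversal-simple m a total simple i i' eq =
    opp-injective i i' (prev-injective (opp i) (opp i') (simple _ _
      (complements (reversed i) (before i) (reversed i') (before i')
        (complementary i) (complementary i') eq)))
    where
    reversed before : Fin K → ℤ
    reversed = partialSum K (λ j → a (opp j))
    before i = partialSum K a (prev (opp i))
    complementary : ∀ i → (reversed i + before i) ≡ + 0 [mod m ]
    complementary i = subst (λ z → (z + before i) ≡ + 0 [mod m ])
      (sym (reversed-partialSum a i)) (suffix+prefix a total (opp i))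

-- For odd K = k' + 1, k' = 2t, the double step x ↦ prev (prev x) links any two
-- elements of Fin K: t + 1 double steps are K + 1 single steps, i.e. one
-- single step back, and single steps back reach everything.
module DoubleStep (k' t : ℕ) (even : k' ≡ 2 * t) where
  open import Data.Nat using (_+_; _∸_; _≤_)
  import Data.Nat.Properties as ℕP
  import Data.Fin.Properties as FinP
  open import Relation.Binary.Construct.Closure.ReflexiveTransitive using (Star; ε; _◅_; _◅◅_)
  open import Relation.Binary.PropositionalEquality using (cong-app)
  open CyclicFin k'
  open import Function.Endo.Propositional (Fin K) using (_^_; ^-homo)

  prev² : Fin K → Fin K
  prev² x = prev (prev x)

  DoubleStep : Fin K → Fin K → Set
  DoubleStep a b = b ≡ prev² a

  prev^-toℕ : ∀ m x → m ≤ toℕ x → toℕ ((prev ^ m) x) ≡ toℕ x ∸ m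
  prev^-toℕ zero x _ = refl
  prev^-toℕ (suc m) x m<x with (prev ^ m) x | prev^-toℕ m x (ℕP.<⇒≤ m<x)
  ... | Fin.zero  | ih = ⊥-elim (ℕP.<⇒≢ (ℕP.m<n⇒0<n∸m m<x) ih)
  ... | Fin.suc y | ih = begin
    toℕ (Fin.inject₁ y) ≡⟨ FinP.toℕ-inject₁ y ⟩
    toℕ y               ≡⟨ cong (_∸ 1) ih ⟩
    toℕ x ∸ m ∸ 1       ≡⟨ ℕP.∸-+-assoc (toℕ x) m 1 ⟩
    toℕ x ∸ (m + 1)     ≡⟨ cong (toℕ x ∸_) (ℕP.+-comm m 1) ⟩
    toℕ x ∸ suc m       ∎
    where open ≡-Reasoning

  -- K single steps back return to the start: x steps to 0, one to the
  -- last element, and K - 1 - x more back to x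
  prev^K : ∀ x → (prev ^ K) x ≡ x
  prev^K x = begin
    (prev ^ K) x                               ≡⟨ cong (λ z → (prev ^ z) x) split ⟩
    (prev ^ (rest + (1 + toℕ x))) x            ≡⟨ cong-app (^-homo prev rest (1 + toℕ x)) x ⟩
    (prev ^ rest) (prev ((prev ^ toℕ x) x))    ≡⟨ cong (λ z → (prev ^ rest) (prev z)) to-zero ⟩
    (prev ^ rest) (prev Fin.zero)              ≡⟨ FinP.toℕ-injective back-to-x ⟩
    x                                          ∎
    where
    open ≡-Reasoning
    x≤last : toℕ x ≤ k'
    x≤last = ℕP.≤-pred (FinP.toℕ<n x)
    rest = k' ∸ toℕ x
    split : K ≡ rest + (1 + toℕ x)
    split = sym (trans (ℕP.+-suc rest (toℕ x)) (cong suc (ℕP.m∸n+n≡m x≤last)))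
    to-zero : (prev ^ toℕ x) x ≡ Fin.zero
    to-zero = FinP.toℕ-injective (trans (prev^-toℕ (toℕ x) x ℕP.≤-refl) (ℕP.n∸n≡0 (toℕ x)))
    back-to-x : toℕ ((prev ^ rest) (prev Fin.zero)) ≡ toℕ x
    back-to-x = begin
      toℕ ((prev ^ rest) (prev Fin.zero)) ≡⟨ prev^-toℕ rest (prev Fin.zero)
                                               (subst (rest ≤_) (sym toℕ-prev-zero) (ℕP.m∸n≤m k' (toℕ x))) ⟩
      toℕ (prev {K} Fin.zero) ∸ rest      ≡⟨ cong (_∸ rest) toℕ-prev-zero ⟩
      k' ∸ rest                           ≡⟨ ℕP.m∸[m∸n]≡n x≤last ⟩
      toℕ x                               ∎

  prev²^ : ∀ m x → (prev² ^ m) x ≡ (prev ^ (m + m)) x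
  prev²^ zero x = refl
  prev²^ (suc m) x rewrite ℕP.+-suc m m = cong prev² (prev²^ m x)

  reach-iterate : ∀ m x → Star DoubleStep x ((prev² ^ m) x)
  reach-iterate zero x = ε
  reach-iterate (suc m) x = reach-iterate m x ◅◅ (refl ◅ ε)

  reach-prev : ∀ x → Star DoubleStep x (prev x)
  reach-prev x = subst (Star DoubleStep x) one-back (reach-iterate (suc t) x)
    where
    one-back : (prev² ^ suc t) x ≡ prev x
    one-back = begin
      (prev² ^ suc t) x            ≡⟨ prev²^ (suc t) x ⟩
      (prev ^ (suc t + suc t)) x   ≡⟨ cong (λ z → (prev ^ z) x) twice-t+1 ⟩
      prev ((prev ^ K) x)          ≡⟨ cong prev (prev^K x) ⟩
      prev x                       ∎
      where
      open ≡-Reasoning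
      twice-t+1 : suc t + suc t ≡ suc K
      twice-t+1 = cong suc (trans (ℕP.+-suc t t)
                                  (cong suc (sym (trans even (cong (t +_) (ℕP.+-identityʳ t))))))

  reach-below : ∀ d a b → toℕ b + d ≡ toℕ a → Star DoubleStep a b
  reach-below zero a b eq =
    subst (Star DoubleStep a) (FinP.toℕ-injective (trans (sym eq) (ℕP.+-identityʳ (toℕ b)))) ε
  reach-below (suc d) Fin.zero b eq = ⊥-elim (ℕP.m+1+n≢0 (toℕ b) eq)
  reach-below (suc d) (Fin.suc a) b eq = reach-prev (Fin.suc a) ◅◅ reach-below d (Fin.inject₁ a) b
    (trans (ℕP.suc-injective (trans (sym (ℕP.+-suc (toℕ b) d)) eq)) (sym (FinP.toℕ-inject₁ a)))

  -- down from a to 0, one step back to the last element, and down to b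
  reach : ∀ a b → Star DoubleStep a b
  reach a b = reach-below (toℕ a) a Fin.zero refl ◅◅ (reach-prev Fin.zero ◅◅
    reach-below (k' ∸ toℕ b) (prev Fin.zero) b
      (trans (ℕP.m+[n∸m]≡n (ℕP.≤-pred (FinP.toℕ<n b))) (sym toℕ-prev-zero)))

module DiagonalOrdering (n' k' : ℕ) (A : Array (suc n')) (g : Fin (suc k') → Fin (suc n'))
  (g-increasing : ∀ h h' → toℕ h < toℕ h' → toℕ (g h) < toℕ (g h'))
  (support : ∀ r c → (Is-just (A r c) ⇔ (∃[ h ] OnDiag (g h) (r , c)))) where

  open import Data.Nat using (suc; _≤_; _≤ᵇ_)
  import Data.Nat.Properties as ℕP
  import Data.Fin.Properties as FinP
  open import Data.Integer using (+_)
  open import Data.Maybe using (just; nothing)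
  import Data.Maybe.Relation.Unary.Any as Maybe
  open import Function.Bundles using (Equivalence)
  open import Relation.Binary.Definitions using (tri<; tri≈; tri>)
  open ZMod n'
  open CyclicFin k'

  g-≤ᵇ : ∀ x y → (toℕ (g x) ≤ᵇ toℕ (g y)) ≡ (toℕ x ≤ᵇ toℕ y)
  g-≤ᵇ x y = T-ext
    (λ gx≤gy → ℕP.≤⇒≤ᵇ (ℕP.≮⇒≥ (λ y<x →
                 ℕP.<⇒≱ (g-increasing y x y<x) (ℕP.≤ᵇ⇒≤ _ _ gx≤gy))))
    (λ x≤y → ℕP.≤⇒≤ᵇ (monotone (ℕP.m≤n⇒m<n∨m≡n (ℕP.≤ᵇ⇒≤ _ _ x≤y))))
    where
    monotone : toℕ x < toℕ y ⊎ toℕ x ≡ toℕ y → toℕ (g x) ≤ toℕ (g y)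
    monotone (inj₁ x<y) = ℕP.<⇒≤ (g-increasing x y x<y)
    monotone (inj₂ x≡y) = ℕP.≤-reflexive (cong (λ z → toℕ (g z)) (FinP.toℕ-injective x≡y))

  g-injective : ∀ x y → g x ≡ g y → x ≡ y
  g-injective x y eq with ℕP.<-cmp (toℕ x) (toℕ y)
  ... | tri< x<y _ _ = ⊥-elim (ℕP.<-irrefl (cong toℕ eq) (g-increasing x y x<y))
  ... | tri≈ _ x≡y _ = FinP.toℕ-injective x≡y
  ... | tri> _ _ y<x = ⊥-elim (ℕP.<-irrefl (cong toℕ (sym eq)) (g-increasing y x y<x))

  filled : ∀ r c h → OnDiag (g h) (r , c) → Filled A (r , c)
  filled r c h on = Equivalence.from (support r c) (h , on)

  empty-or-on-diagonal : ∀ r c → val (A r c) ≡ + 0 ⊎ ∃[ h ] OnDiag (g h) (r , c)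
  empty-or-on-diagonal r c with A r c in eq
  ... | nothing = inj₁ refl
  ... | just _  = inj₂ (Equivalence.to (support r c) (subst Is-just (sym eq) (Maybe.just tt)))

  rowList : Fin N → Fin K → Fin N
  rowList r j = r ⊖ g (opp j)

  colNatural : Fin N → Fin K → Fin N
  colNatural c j = c ⊕ g j

  colList : Fin N → Fin K → Fin N
  colList Fin.zero    j = colNatural Fin.zero (opp j)
  colList (Fin.suc c) j = colNatural (Fin.suc c) j

  colNatural-injective : ∀ c j j' → colNatural c j ≡ colNatural c j' → j ≡ j'
  colNatural-injective c j j' eq = g-injective j j' (⊕-injʳ c (g j) (g j') eq)

  ordering : Ordering N K A
  ordering = record
    { ρ = rowList ; κ = colList
    ; ρ-filled = λ r j → filled r (rowList r j) (opp j) (onDiag-⊖ r (g (opp j)))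
    ; κ-filled = colList-filled
    ; ρ-inj = λ r j j' eq → opp-injective j j' (g-injective _ _ (⊖-injʳ r _ _ eq))
    ; κ-inj = colList-injective }
    where
    colList-filled : ∀ c j → Filled A (colList c j , c)
    colList-filled Fin.zero    j = filled _ Fin.zero (opp j) (onDiag-⊕ (g (opp j)) Fin.zero)
    colList-filled (Fin.suc c) j = filled _ (Fin.suc c) j (onDiag-⊕ (g j) (Fin.suc c))
    colList-injective : ∀ c j j' → colList c j ≡ colList c j' → j ≡ j'
    colList-injective Fin.zero    j j' eq =
      opp-injective j j' (colNatural-injective Fin.zero (opp j) (opp j') eq)
    colList-injective (Fin.suc c) j j' eq = colNatural-injective (Fin.suc c) j j' eq

  -- Every row and column listing is a rotation of the natural ordering
  -- (column 0: a reversed rotation), hence simple when A is globally simple.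
  module Simplicity (H : IsHeffter N K A) (globally : GloballySimple N K A) where
    open Rotation using (rotation-simple)
    open Reversal k' using (reversal-simple)
    open Sums using (sum-reindex)

    M : ℕ
    M = modulus N K

    row-simple : ∀ r → SimpleSeq M K (λ j → val (A r (rowList r j)))
    row-simple r = rotation-simple N K (λ c → val (A r c)) (rowList r) (suc (toℕ r))
      (Ordering.ρ-inj ordering r) listed follows (IsHeffter.rowSum H r)
      (λ i i' → proj₁ globally r (rowList r i) (rowList r i')
                  (Ordering.ρ-filled ordering r i) (Ordering.ρ-filled ordering r i'))
      where
      listed : ∀ c → val (A r c) ≡ + 0 ⊎ ∃[ j ] rowList r j ≡ c
      listed c with empty-or-on-diagonal r c
      ... | inj₁ empty   = inj₁ empty
      ... | inj₂ (h , on) =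
        inj₂ (opp h , trans (cong (λ z → r ⊖ g z) (opp-involutive h)) (sym (onDiag⇒col (g h) r c on)))
      follows : ∀ i j →
        (toℕ j ≤ᵇ toℕ i) ≡ Rotation.cyclicLeᵇ (suc (toℕ r)) (toℕ (rowList r j)) (toℕ (rowList r i))
      follows i j = sym (trans (⊖-cyclicLe r (g (opp j)) (g (opp i)))
                               (trans (g-≤ᵇ (opp i) (opp j)) (opp-≤ᵇ i j)))

    module Column (c : Fin N) where
      listed : ∀ r → val (A r c) ≡ + 0 ⊎ ∃[ j ] colNatural c j ≡ r
      listed r with empty-or-on-diagonal r c
      ... | inj₁ empty   = inj₁ empty
      ... | inj₂ (h , on) = inj₂ (h , sym (onDiag⇒row (g h) r c on))

      natural-simple : SimpleSeq M K (λ j → val (A (colNatural c j) c))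
      natural-simple = rotation-simple N K (λ r → val (A r c)) (colNatural c) (toℕ c)
        (colNatural-injective c) listed
        (λ i j → sym (trans (⊕-cyclicLe c (g j) (g i)) (g-≤ᵇ j i))) (IsHeffter.colSum H c)
        (λ i i' → proj₂ globally c (colNatural c i) (colNatural c i')
                    (filled _ c i (onDiag-⊕ (g i) c)) (filled _ c i' (onDiag-⊕ (g i') c)))

      total : sumℤ K (λ j → val (A (colNatural c j) c)) ≡ + 0 [mod M ]
      total = subst (λ z → z ≡ + 0 [mod M ])
                (sum-reindex N K (colNatural c) (colNatural-injective c) _ listed) (IsHeffter.colSum H c)

    col-simple : ∀ c → SimpleSeq M K (λ j → val (A (colList c j) c))
    col-simple Fin.zero    = reversal-simple M (λ j → val (A (colNatural Fin.zero j) Fin.zero))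
                               (Column.total Fin.zero) (Column.natural-simple Fin.zero)
    col-simple (Fin.suc c) = Column.natural-simple (Fin.suc c)

    simple : IsSimpleOrdering ordering
    simple = row-simple , col-simple

  -- One step of ω_r ∘ ω_c moves
  -- cell h c to cell h (c + σ_h) when c ≠ 0, and cell h 0 to
  -- cell (h-2) σ_{h-2}.  As σ_h is a unit of ℤ_N, iterating the first kind of
  -- step runs through every column of diagonal h before reaching column 0;
  -- as K is odd, the jumps h ↦ h - 2 visit every diagonal.
  module Compatibility (t : ℕ) (even : k' ≡ 2 * t)
    (coprime : ∀ h → gcd N (diffMod N (g h) (g (prev h))) ≡ 1) where
    open import Data.Nat using (_+_; _∸_; _≤_; _%_)
    open import Data.Nat.Coprimality using (Coprime; gcd≡1⇒coprime)
    open import Relation.Binary.Construct.Closure.ReflexiveTransitive using (Star; ε; _◅_; _◅◅_)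
    open DoubleStep k' t even using (prev²; DoubleStep; reach)

    Step : Cell N → Cell N → Set
    Step = ωrc ordering

    cell : Fin K → Fin N → Cell N
    cell h c = (c ⊕ g h , c)

    σ : Fin K → ℕ
    σ h = diffMod N (g (next h)) (g h)

    -- in column c ≠ 0, ω_c moves down from diagonal h to diagonal h + 1, and
    -- ω_r then moves along the row back to diagonal h, σ_h columns further
    step-inside : ∀ h (c : Fin N) → toℕ c ≢ 0 → Step (cell h c) (cell h (res (toℕ c + σ h)))
    step-inside h Fin.zero    c≢0 = ⊥-elim (c≢0 refl)
    step-inside h (Fin.suc c) _   = (c' ⊕ g (next h) , c') ,
        (refl , next h , cong (λ w → c' ⊕ g w) (prev-next h) , refl) ,
        (⊕-shift c' (g (next h)) (g h) , opp h , ⊕-⊖-cancel c' (g (next h)) ,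
         trans (cong (λ w → (c' ⊕ g (next h)) ⊖ g w) (opp-involutive h))
               (⊕-⊖-shift c' (g (next h)) (g h)))
      where
      c' = Fin.suc c

    σ-prev² : ∀ h → σ (prev² h) ≡ diffMod N (g (prev h)) (g (prev² h))
    σ-prev² h = cong (λ w → diffMod N (g w) (g (prev² h))) (next-prev (prev h))

    -- column 0 is listed backwards: ω_c moves from diagonal h to h - 1, and
    -- ω_r then moves along the row to diagonal h - 2
    step-wrap : ∀ h → Step (cell h Fin.zero) (cell (prev² h) (res (σ (prev² h))))
    step-wrap h rewrite σ-prev² h = (r , Fin.zero) ,
        (refl , opp (prev h) , cong (λ w → Fin.zero ⊕ g w) (next-prev h) ,
         cong (λ w → Fin.zero ⊕ g w) (opp-involutive (prev h))) ,
        (⊕-shift Fin.zero (g (prev h)) (g (prev² h)) , opp (prev² h) ,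
         trans (cong (λ w → r ⊖ g w) (next-prev (prev h))) (⊕-⊖-cancel Fin.zero (g (prev h))) ,
         trans (cong (λ w → r ⊖ g w) (opp-involutive (prev² h)))
               (⊕-⊖-shift Fin.zero (g (prev h)) (g (prev² h))))
      where
      r = Fin.zero ⊕ g (prev h)

    σ-coprime : ∀ h → Coprime N (σ h)
    σ-coprime h = gcd≡1⇒coprime
      (subst (λ w → gcd N (diffMod N (g (next h)) (g w)) ≡ 1) (prev-next h) (coprime (next h)))

    walk : ∀ h a d → 1 ≤ a → a + d ≤ N →
      Star Step (cell h (res (a * σ h))) (cell h (res ((a + d) * σ h)))
    walk h a zero    _   _ rewrite ℕP.+-identityʳ a = ε
    walk h a (suc d) 1≤a a+d<N = walk h a d 1≤a (ℕP.<⇒≤ a+d<N') ◅◅ (onward ◅ ε)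
      where
      open Multiples (σ h) (σ-coprime h) using (multiple-≢0)
      a+d<N' : a + d < N
      a+d<N' = subst (_≤ N) (ℕP.+-suc a d) a+d<N
      here = res ((a + d) * σ h)
      here≢0 : toℕ here ≢ 0
      here≢0 eq = multiple-≢0 (a + d) (ℕP.≤-trans 1≤a (ℕP.m≤m+n a d)) a+d<N'
                    (trans (sym (toℕ-res ((a + d) * σ h))) eq)
      next-column : res (toℕ here + σ h) ≡ res ((a + suc d) * σ h)
      next-column = res-cong (toℕ here + σ h) ((a + suc d) * σ h) (begin
        (toℕ here + σ h) % N                ≡⟨ %-cong-+ {toℕ here} {(a + d) * σ h} {σ h} {σ h}
                                                  (toℕ-res-% ((a + d) * σ h)) refl ⟩
        ((a + d) * σ h + σ h) % N           ≡⟨ cong (_% N) (ℕP.+-comm ((a + d) * σ h) (σ h)) ⟩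
        (suc (a + d) * σ h) % N             ≡⟨ cong (λ z → (z * σ h) % N) (sym (ℕP.+-suc a d)) ⟩
        ((a + suc d) * σ h) % N             ∎)
        where open ≡-Reasoning
      onward : Step (cell h here) (cell h (res ((a + suc d) * σ h)))
      onward = subst (λ w → Step (cell h here) (cell h w)) next-column (step-inside h here here≢0)

    to-column-0 : ∀ h c → Star Step (cell h c) (cell h Fin.zero)
    to-column-0 h c with Multiples.every-residue (σ h) (σ-coprime h) c
    ... | u , 1≤u , u≤N , u·σ≡c =
      subst₂ (λ a b → Star Step (cell h a) (cell h b)) u·σ≡c N·σ≡0
        (walk h u (N ∸ u) 1≤u (ℕP.≤-reflexive (ℕP.m+[n∸m]≡n u≤N)))
      where
      N·σ≡0 : res ((u + (N ∸ u)) * σ h) ≡ Fin.zero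
      N·σ≡0 = fin-≡-% _ _ (trans (toℕ-res-% ((u + (N ∸ u)) * σ h))
        (trans (cong (λ z → (z * σ h) % N) (ℕP.m+[n∸m]≡n u≤N)) (N·s≡0 (σ h))))

    from-column-σ : ∀ h c → Star Step (cell h (res (σ h))) (cell h c)
    from-column-σ h c with Multiples.every-residue (σ h) (σ-coprime h) c
    ... | u , 1≤u , u≤N , u·σ≡c =
      subst₂ (λ a b → Star Step (cell h a) (cell h b)) (cong res (ℕP.*-identityˡ (σ h)))
        (trans (cong (λ z → res (z * σ h)) (ℕP.m+[n∸m]≡n 1≤u)) u·σ≡c)
        (walk h 1 (u ∸ 1) ℕP.≤-refl (subst (_≤ N) (sym (ℕP.m+[n∸m]≡n 1≤u)) u≤N))

    across : ∀ h c → Star Step (cell h Fin.zero) (cell (prev² h) c)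
    across h c = step-wrap h ◅ from-column-σ (prev² h) c

    along : ∀ {a b} → Star DoubleStep a b → Star Step (cell a Fin.zero) (cell b Fin.zero)
    along ε              = ε
    along (refl ◅ steps) = across _ Fin.zero ◅◅ along steps

    as-cell : ∀ r c → Filled A (r , c) → ∃[ h ] (r , c) ≡ cell h c
    as-cell r c filled-rc with Equivalence.to (support r c) filled-rc
    ... | h , on = h , cong (_, c) (onDiag⇒row (g h) r c on)

    compatible : IsCompatible ordering
    compatible (r , c) (r' , c') filled-x filled-y with as-cell r c filled-x | as-cell r' c' filled-y
    ... | h , x≡ | h' , y≡ = subst₂ (Star Step) (sym x≡) (sym y≡)
      (to-column-0 h c ◅◅ along (reach h h'') ◅◅
       subst (λ w → Star Step (cell h'' Fin.zero) (cell w c')) lands (across h'' c'))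
      where
      h'' = next (next h')
      lands : prev² h'' ≡ h'
      lands = trans (cong prev (prev-next (next h'))) (prev-next h')

mainTheorem6 : (n k : ℕ) → Odd k → (A : Array n) → IsHeffter n k A →
    (g : Fin k → Fin n) → (∀ h h' → toℕ h < toℕ h' → toℕ (g h) < toℕ (g h')) →
    (∀ r c → (Is-just (A r c) ⇔ (∃[ h ] OnDiag (g h) (r , c)))) →
    (∀ h → gcd n (diffMod n (g h) (g (prev h))) ≡ 1) →
    GloballySimple n k A →
    Σ (Ordering n k A) (λ O → IsSimpleOrdering O × IsCompatible O)
-- with no rows there is no place for the diagonal D_{g(0)}
mainTheorem6 zero    _ (t , refl) A H g increasing support coprime globally with g Fin.zero
... | ()
mainTheorem6 (suc n') _ (t , refl) A H g increasing support coprime globally =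
  ordering , Simplicity.simple H globally , Compatibility.compatible t refl coprime
  where open DiagonalOrdering n' (2 * t) A g increasing support
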